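{- Let HT be the formal system defined in the context below, for an arbitrary fixed enumeration $(A_i)_{i\ge 1}$ of all formulas. Then the formula $T(\bot)$ (that is, the propositional variable $p_j$ for the unique index $j$ with $A_j=\bot$) is not a theorem of HT.
   Context: Language: a propositional language with countably many propositional variables $p_1,p_2,\ldots$ and a propositional constant $\bot$; formulas are built from the variables and $\bot$ using the binary connectives $\wedge$, $\vee$, $\to$. We write $\neg A$ for $A\to\bot$ and $A\leftrightarrow B$ for $(A\to B)\wedge(B\to A)$. Fix an enumeration $(A_i)_{i\ge1}$ of all formulas of this language in which every formula occurs exactly once (the $A_i$ are distinct). For a formula $A=A_i$, write $T(A)$ for the propositional variable $p_i$ (intended reading: "$A$ is true"). The system HT consists of: (i) the axioms and deduction rule of the minimal propositional calculus (intuitionistic propositional calculus without ex falso quodlibet, $\bot$ being treated as an ordinary atom), e.g. all instances of $A\to(B\to A)$, $(A\to(B\to C))\to((A\to B)\to(A\to C))$, $A\wedge B\to A$, $A\wedge B\to B$, $A\to(B\to A\wedge B)$, $A\to A\vee B$, $B\to A\vee B$, $(A\to C)\to((B\to C)\to(A\vee B\to C))$, with modus ponens as the rule; (ii) for all formulas $A,B,C$ the axioms $A\to T(A)$; $T(A)\wedge T(B)\leftrightarrow T(A\wedge B)$; $T(A)\vee T(B)\to T(A\vee B)$; $T(A\vee B)\wedge T(A\to C)\wedge T(B\to C)\to T(C)$; $T(A)\wedge T(A\to B)\to T(B)$. A theorem of HT is a formula derivable from these axioms by modus ponens. -}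

module Defs where

open import Data.Nat using (ℕ)
open import Function.Bundles using (_↔_; Inverse)

-- Formulas: variables p_{n+1} are represented by  var n  (n : ℕ), plus ⊥ and ∧, ∨, →.
data Formula : Set where
  var  : ℕ → Formula
  ⊥'   : Formula
  _∧'_ : Formula → Formula → Formula
  _∨'_ : Formula → Formula → Formula
  _⇒_  : Formula → Formula → Formula

infixr 6 _∧'_
infixr 5 _∨'_
infixr 4 _⇒_

¬' : Formula → Formula
¬' A = A ⇒ ⊥'

_⇔'_ : Formula → Formula → Formula
A ⇔' B = (A ⇒ B) ∧' (B ⇒ A)

-- An enumeration (A_i) of all formulas, each occurring exactly once, is a bijection
-- ℕ ↔ Formula (index n stands for i = n+1).  T(A_i) = p_i, i.e. T A = var (from A).
Enumeration : Set
Enumeration = ℕ ↔ Formula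

module HT (e : Enumeration) where
  open Inverse e using (from)

  T : Formula → Formula
  T A = var (from A)

  data ⊢_ : Formula → Set where
    ax-K     : ∀ {A B} → ⊢ (A ⇒ (B ⇒ A))
    ax-S     : ∀ {A B C} → ⊢ ((A ⇒ (B ⇒ C)) ⇒ ((A ⇒ B) ⇒ (A ⇒ C)))
    ax-∧E₁   : ∀ {A B} → ⊢ (A ∧' B ⇒ A)
    ax-∧E₂   : ∀ {A B} → ⊢ (A ∧' B ⇒ B)
    ax-∧I    : ∀ {A B} → ⊢ (A ⇒ (B ⇒ A ∧' B))
    ax-∨I₁   : ∀ {A B} → ⊢ (A ⇒ A ∨' B)
    ax-∨I₂   : ∀ {A B} → ⊢ (B ⇒ A ∨' B)
    ax-∨E    : ∀ {A B C} → ⊢ ((A ⇒ C) ⇒ ((B ⇒ C) ⇒ (A ∨' B ⇒ C)))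
    ax-T     : ∀ {A} → ⊢ (A ⇒ T A)
    ax-T∧    : ∀ {A B} → ⊢ ((T A ∧' T B) ⇔' T (A ∧' B))
    ax-T∨    : ∀ {A B} → ⊢ (T A ∨' T B ⇒ T (A ∨' B))
    ax-T∨E   : ∀ {A B C} → ⊢ (T (A ∨' B) ∧' T (A ⇒ C) ∧' T (B ⇒ C) ⇒ T C)
    ax-T⇒    : ∀ {A B} → ⊢ (T A ∧' T (A ⇒ B) ⇒ T B)
    mp       : ∀ {A B} → ⊢ (A ⇒ B) → ⊢ A → ⊢ B

  infix 2 ⊢_

module Submission where

open import Defs
open import Relation.Nullary using (¬_)
open import Data.Nat using (ℕ; zero; suc; _≤′_; _<′_; ≤′-refl; ≤′-step)
open import Data.Nat.Properties using (≤′-trans)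
open import Data.Unit using (⊤; tt)
open import Data.Empty using (⊥)
open import Data.Product using (_×_; _,_; proj₁; proj₂)
open import Data.Sum using (_⊎_; inj₁; inj₂)
open import Relation.Binary.PropositionalEquality using (subst; sym)
open import Function.Bundles using (Inverse)

-- Idea: take the Kripke model whose worlds are the naturals, world n seeing every
-- m ≤ n, and force the variable p_i = T(A_i) at n iff A_i is forced at every m < n.
-- Then T A holds at n iff A holds strictly below n, which validates all axioms of HT
-- (A → T A by persistence, the rest pointwise) while ⊥ is never forced.
-- So T ⊥ fails at world 1, since it would force ⊥ at world 0.

module KripkeModel (e : Enumeration) where
  open Inverse e using (to; from; strictlyInverseˡ)
  open HT e

  infix 3 _⊩_

  -- Defined by recursion on the world first, so that "for all m ≤ n" (for →) and
  -- "for all m < n" (for variables) unfold into finite products.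
  _⊩_ : ℕ → Formula → Set
  n       ⊩ ⊥'      = ⊥
  n       ⊩ A ∧' B  = n ⊩ A × n ⊩ B
  n       ⊩ A ∨' B  = n ⊩ A ⊎ n ⊩ B
  zero    ⊩ A ⇒ B   = zero ⊩ A → zero ⊩ B
  suc n   ⊩ A ⇒ B   = (suc n ⊩ A → suc n ⊩ B) × n ⊩ A ⇒ B
  zero    ⊩ var i   = ⊤
  suc n   ⊩ var i   = n ⊩ var i × n ⊩ to i

  ⊩-step : ∀ {n} A → suc n ⊩ A → n ⊩ A
  ⊩-step (var i)  (x , _)  = x
  ⊩-step (A ∧' B) (a , b)  = ⊩-step A a , ⊩-step B b
  ⊩-step (A ∨' B) (inj₁ a) = inj₁ (⊩-step A a)
  ⊩-step (A ∨' B) (inj₂ b) = inj₂ (⊩-step B b)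
  ⊩-step (A ⇒ B)  (_ , f)  = f

  ⊩-mono : ∀ {m n} A → m ≤′ n → n ⊩ A → m ⊩ A
  ⊩-mono A ≤′-refl     x = x
  ⊩-mono A (≤′-step p) x = ⊩-mono A p (⊩-step A x)

  ⊩⇒-elim : ∀ {m n A B} → n ⊩ A ⇒ B → m ≤′ n → m ⊩ A → m ⊩ B
  ⊩⇒-elim {n = zero}  f       ≤′-refl     = f
  ⊩⇒-elim {n = suc n} (f , _) ≤′-refl     = f
  ⊩⇒-elim {n = suc n} (_ , f) (≤′-step p) = ⊩⇒-elim f p

  ⊩⇒-intro : ∀ {n A B} → (∀ {m} → m ≤′ n → m ⊩ A → m ⊩ B) → n ⊩ A ⇒ B
  ⊩⇒-intro {zero}  h = h ≤′-refl
  ⊩⇒-intro {suc n} h = h ≤′-refl , ⊩⇒-intro (λ p → h (≤′-step p))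

  ⊩var-elim : ∀ {m n i} → n ⊩ var i → m <′ n → m ⊩ to i
  ⊩var-elim {n = suc n} (_ , x) ≤′-refl     = x
  ⊩var-elim {n = suc n} (x , _) (≤′-step p) = ⊩var-elim x p

  ⊩var-intro : ∀ {n i} → (∀ {m} → m <′ n → m ⊩ to i) → n ⊩ var i
  ⊩var-intro {zero}  h = tt
  ⊩var-intro {suc n} h = ⊩var-intro (λ p → h (≤′-step p)) , h ≤′-refl

  ⊩T-elim : ∀ {m n A} → n ⊩ T A → m <′ n → m ⊩ A
  ⊩T-elim {A = A} t p = subst (_ ⊩_) (strictlyInverseˡ A) (⊩var-elim t p)

  ⊩T-intro : ∀ {n A} → (∀ {m} → m <′ n → m ⊩ A) → n ⊩ T A
  ⊩T-intro {A = A} h = ⊩var-intro (λ p → subst (_ ⊩_) (sym (strictlyInverseˡ A)) (h p))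

  ⊩∨-elim : ∀ {n A B C} → n ⊩ A ∨' B → n ⊩ A ⇒ C → n ⊩ B ⇒ C → n ⊩ C
  ⊩∨-elim (inj₁ a) f _ = ⊩⇒-elim f ≤′-refl a
  ⊩∨-elim (inj₂ b) _ g = ⊩⇒-elim g ≤′-refl b

  soundness : ∀ {A} → ⊢ A → ∀ n → n ⊩ A
  soundness (ax-K {A}) n = ⊩⇒-intro λ _ a → ⊩⇒-intro λ q _ → ⊩-mono A q a
  soundness ax-S n = ⊩⇒-intro λ _ f → ⊩⇒-intro λ q g → ⊩⇒-intro λ r a →
    ⊩⇒-elim (⊩⇒-elim f (≤′-trans r q) a) ≤′-refl (⊩⇒-elim g r a)
  soundness ax-∧E₁ n = ⊩⇒-intro λ _ → proj₁
  soundness ax-∧E₂ n = ⊩⇒-intro λ _ → proj₂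
  soundness (ax-∧I {A}) n = ⊩⇒-intro λ _ a → ⊩⇒-intro λ q b → ⊩-mono A q a , b
  soundness ax-∨I₁ n = ⊩⇒-intro λ _ → inj₁
  soundness ax-∨I₂ n = ⊩⇒-intro λ _ → inj₂
  soundness (ax-∨E {A} {B} {C}) n = ⊩⇒-intro λ _ f → ⊩⇒-intro λ q g → ⊩⇒-intro λ r x →
    ⊩∨-elim x (⊩-mono (A ⇒ C) (≤′-trans r q) f) (⊩-mono (B ⇒ C) r g)
  soundness (ax-T {A}) n = ⊩⇒-intro λ _ a → ⊩T-intro λ q → ⊩-mono A (≤′-trans (≤′-step ≤′-refl) q) a
  soundness ax-T∧ n =
      (⊩⇒-intro λ _ x → ⊩T-intro λ q → ⊩T-elim (proj₁ x) q , ⊩T-elim (proj₂ x) q)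
    , (⊩⇒-intro λ _ x → ⊩T-intro (λ q → proj₁ (⊩T-elim x q)) , ⊩T-intro (λ q → proj₂ (⊩T-elim x q)))
  soundness ax-T∨ n = ⊩⇒-intro λ where
    _ (inj₁ x) → ⊩T-intro λ q → inj₁ (⊩T-elim x q)
    _ (inj₂ y) → ⊩T-intro λ q → inj₂ (⊩T-elim y q)
  soundness ax-T∨E n = ⊩⇒-intro λ _ (x , f , g) → ⊩T-intro λ q →
    ⊩∨-elim (⊩T-elim x q) (⊩T-elim f q) (⊩T-elim g q)
  soundness ax-T⇒ n = ⊩⇒-intro λ _ (a , f) → ⊩T-intro λ q → ⊩⇒-elim (⊩T-elim f q) ≤′-refl (⊩T-elim a q)
  soundness (mp d d′) n = ⊩⇒-elim (soundness d n) ≤′-refl (soundness d′ n)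

theorem6p1 : (e : Enumeration) → ¬ (HT.⊢_ e (HT.T e ⊥'))
theorem6p1 e ⊢T⊥ = ⊩T-elim (soundness ⊢T⊥ 1) ≤′-refl
  where open KripkeModel e
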